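{- Let $\mathbb{V}$ be a vector space of dimension $n$ over the field with $2$ elements, with basis $B=\{b_1,\dots,b_n\}$, and let $G(\mathbb{V})$ be its non-zero component graph. Then the symmetric group on $B$ is isomorphic (as a group) to the automorphism group $\mathrm{Aut}(G(\mathbb{V}))$.
   Context: The non-zero component graph $G(\mathbb{V})$ of a finite-dimensional vector space $\mathbb{V}$ with a fixed basis $\{b_1,\dots,b_n\}$ has as vertex set the non-zero vectors of $\mathbb{V}$, two distinct vertices being adjacent if and only if there is some $b_i$ having non-zero coefficient in the expansions of both vectors with respect to the basis. -}

module Defs where

open import Data.Bool.Base using (Bool; true; false)
open import Data.Nat.Base using (ℕ)
open import Data.Fin.Base using (Fin)
open import Data.Vec.Base using (Vec; lookup)
open import Data.Product.Base using (Σ; ∃; ∃-syntax; _×_; proj₁)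
open import Relation.Binary.PropositionalEquality using (_≡_; _≢_)
open import Function.Bundles using (_⇔_)
open import Data.Fin.Permutation using (Permutation′; _⟨$⟩ʳ_; _∘ₚ_)

-- The vector space V = 𝔽₂ⁿ with its fixed (standard) basis b₁,…,bₙ.
-- A vector is given by its coordinate vector w.r.t. the basis; the
-- field with two elements 𝔽₂ is represented by Bool (false = 0, true = 1).

𝔽₂ : Set
𝔽₂ = Bool

V : ℕ → Set
V n = Vec 𝔽₂ n

Supp : ∀ {n} → V n → Fin n → Set
Supp v i = lookup v i ≡ true

NonZeroVec : ∀ {n} → V n → Set
NonZeroVec v = ∃[ i ] Supp v i

Vertex : ℕ → Set
Vertex n = Σ (V n) NonZeroVec

_≈V_ : ∀ {n} → Vertex n → Vertex n → Set
u ≈V w = proj₁ u ≡ proj₁ w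

Adj : ∀ {n} → Vertex n → Vertex n → Set
Adj u w = (proj₁ u ≢ proj₁ w) × (∃[ i ] (Supp (proj₁ u) i × Supp (proj₁ w) i))

record Aut (n : ℕ) : Set where
  field
    to       : Vertex n → Vertex n
    from     : Vertex n → Vertex n
    to-cong  : ∀ {u w} → u ≈V w → to u ≈V to w
    from-cong : ∀ {u w} → u ≈V w → from u ≈V from w
    inverseˡ : ∀ u → to (from u) ≈V u
    inverseʳ : ∀ u → from (to u) ≈V u
    adj      : ∀ u w → Adj u w ⇔ Adj (to u) (to w)
open Aut public

_≈A_ : ∀ {n} → Aut n → Aut n → Set
α ≈A β = ∀ u → to α u ≈V to β u

-- composition in diagrammatic order: apply α first, then β
-- (same convention as _∘ₚ_ on permutations)
_⨾A_ : ∀ {n} → Aut n → Aut n → Aut n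
α ⨾A β = record
  { to = λ u → to β (to α u)
  ; from = λ u → from α (from β u)
  ; to-cong = λ e → to-cong β (to-cong α e)
  ; from-cong = λ e → from-cong α (from-cong β e)
  ; inverseˡ = λ u → trans′ (to-cong β (inverseˡ α (from β u))) (inverseˡ β u)
  ; inverseʳ = λ u → trans′ (from-cong α (inverseʳ β (to α u))) (inverseʳ α u)
  ; adj = λ u w → ⇔-trans (adj α u w) (adj β (to α u) (to α w))
  }
  where
  open import Relation.Binary.PropositionalEquality using () renaming (trans to trans′)
  open import Function.Properties.Equivalence using () renaming (trans to ⇔-trans)

-- The symmetric group on B = {b₁,…,bₙ} (indexed by Fin n):
-- Permutation′ n with composition _∘ₚ_ and pointwise equality.

_≈P_ : ∀ {n} → Permutation′ n → Permutation′ n → Set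
σ ≈P τ = ∀ i → σ ⟨$⟩ʳ i ≡ τ ⟨$⟩ʳ i

record IsGroupIso {n : ℕ} (Φ : Permutation′ n → Aut n) : Set where
  field
    cong       : ∀ {σ τ} → σ ≈P τ → Φ σ ≈A Φ τ
    homo       : ∀ σ τ → Φ (σ ∘ₚ τ) ≈A (Φ σ ⨾A Φ τ)
    injective  : ∀ {σ τ} → Φ σ ≈A Φ τ → σ ≈P τ
    surjective : ∀ α → ∃[ σ ] (Φ σ ≈A α)

SymIsoAut : ℕ → Set
SymIsoAut n = Σ (Permutation′ n → Aut n) IsGroupIso

-- Coordinate permutations preserve adjacency, and the resulting map Sym(B) → Aut is an
-- injective homomorphism because σ sends the vertex bᵢ to b_{σ i}.  For surjectivity, say
-- that two vertices meet when they are equal or adjacent.  The basis vectors are exactly the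
-- vertices whose meeting-neighbourhood is a clique: everything meeting bᵢ has coordinate i,
-- whereas a vector with two coordinates i ≠ j meets bᵢ and bⱼ, which do not meet.  So an
-- automorphism α maps each bᵢ to some b_{π i}, π is a permutation, and since v has
-- coordinate i exactly when v meets bᵢ, α v has coordinate π i exactly when v has
-- coordinate i: α is induced by π.

module Submission where

open import Defs
open import Data.Nat.Base using (ℕ)
open import Data.Bool.Base using (true)
open import Data.Bool.Properties using (⇔→≡) renaming (_≟_ to _≟ᴮ_)
open import Data.Fin.Base using (Fin)
open import Data.Fin.Properties using (_≟_)
open import Data.Fin.Permutation
  using (Permutation′; _⟨$⟩ʳ_; _⟨$⟩ˡ_; _∘ₚ_; permutation; flip)
  renaming (inverseˡ to ⟨$⟩ˡ∘⟨$⟩ʳ; inverseʳ to ⟨$⟩ʳ∘⟨$⟩ˡ)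
open import Data.Vec.Base using (lookup; tabulate)
open import Data.Vec.Properties using (lookup∘tabulate; tabulate∘lookup; tabulate-cong; ≡-dec)
open import Data.Product.Base using (∃-syntax; _×_; _,_; proj₁; proj₂)
open import Data.Product.Function.NonDependent.Propositional using (_×-cong_)
open import Function.Bundles using (_⇔_; mk⇔; Equivalence)
open import Function.Related.Propositional using (module EquationalReasoning)
open import Function.Related.TypeIsomorphisms using (¬-cong-⇔)
open import Function.Properties.Equivalence using () renaming (sym to ⇔-sym)
open import Relation.Nullary using (Dec; does; yes; no)
open import Relation.Nullary.Decidable using (dec-true)
open import Relation.Binary.PropositionalEquality
  using (_≡_; refl; sym; trans; cong; subst; subst₂; module ≡-Reasoning)

private
  variable
    n : ℕ

≡-fromLookup : {u w : V n} → (∀ i → lookup u i ≡ lookup w i) → u ≡ w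
≡-fromLookup {u = u} {w} h = begin
  u                    ≡⟨ tabulate∘lookup u ⟨
  tabulate (lookup u)  ≡⟨ tabulate-cong h ⟩
  tabulate (lookup w)  ≡⟨ tabulate∘lookup w ⟩
  w                    ∎
  where open ≡-Reasoning

≡-fromSupp : {u w : V n} → (∀ i → Supp u i ⇔ Supp w i) → u ≡ w
≡-fromSupp h = ≡-fromLookup (λ i → ⇔→≡ (h i))

Meets : V n → V n → Set
Meets u w = ∃[ i ] (Supp u i × Supp w i)

Meets-self : (u : Vertex n) → Meets (proj₁ u) (proj₁ u)
Meets-self (_ , i , s) = i , s , s

unit : Fin n → V n
unit i = tabulate (λ k → does (k ≟ i))

Supp-unit : (i k : Fin n) → Supp (unit i) k ⇔ k ≡ i
Supp-unit i k = mk⇔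
  (λ s → does⇒ (k ≟ i) (trans (sym (lookup∘tabulate _ k)) s))
  (λ k≡i → trans (lookup∘tabulate _ k) (dec-true (k ≟ i) k≡i))
  where
  does⇒ : ∀ {A : Set} (a? : Dec A) → does a? ≡ true → A
  does⇒ (yes a) _ = a

Supp-unit-self : (i : Fin n) → Supp (unit i) i
Supp-unit-self i = Equivalence.from (Supp-unit i i) refl

unit-injective : {i k : Fin n} → unit i ≡ unit k → i ≡ k
unit-injective {i = i} {k} eq =
  Equivalence.to (Supp-unit k i) (subst (λ u → Supp u i) eq (Supp-unit-self i))

unitVertex : Fin n → Vertex n
unitVertex i = unit i , i , Supp-unit-self i

Meets-unit : (v : V n) (i : Fin n) → Meets v (unit i) ⇔ Supp v i
Meets-unit v i = mk⇔
  (λ (k , sv , su) → subst (Supp v) (Equivalence.to (Supp-unit i k) su) sv)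
  (λ s → i , s , Supp-unit-self i)

permute : Permutation′ n → V n → V n
permute σ v = tabulate (λ j → lookup v (σ ⟨$⟩ˡ j))

lookup-permute : (σ : Permutation′ n) (v : V n) (j : Fin n) →
  lookup (permute σ v) j ≡ lookup v (σ ⟨$⟩ˡ j)
lookup-permute σ v = lookup∘tabulate (λ j → lookup v (σ ⟨$⟩ˡ j))

lookup-permute-⟨$⟩ʳ : (σ : Permutation′ n) (v : V n) (i : Fin n) →
  lookup (permute σ v) (σ ⟨$⟩ʳ i) ≡ lookup v i
lookup-permute-⟨$⟩ʳ σ v i = trans (lookup-permute σ v _) (cong (lookup v) (⟨$⟩ˡ∘⟨$⟩ʳ σ))

permute-flip : (σ : Permutation′ n) (v : V n) → permute σ (permute (flip σ) v) ≡ v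
permute-flip σ v = ≡-fromLookup λ j →
  trans (lookup-permute σ (permute (flip σ) v) j) (lookup-permute-⟨$⟩ʳ (flip σ) v j)

permute-injective : (σ : Permutation′ n) {u w : V n} → permute σ u ≡ permute σ w → u ≡ w
permute-injective σ {u} {w} eq = begin
  u                               ≡⟨ permute-flip (flip σ) u ⟨
  permute (flip σ) (permute σ u)  ≡⟨ cong (permute (flip σ)) eq ⟩
  permute (flip σ) (permute σ w)  ≡⟨ permute-flip (flip σ) w ⟩
  w                               ∎
  where open ≡-Reasoning

permute-∘ₚ : (σ τ : Permutation′ n) (v : V n) → permute (σ ∘ₚ τ) v ≡ permute τ (permute σ v)
permute-∘ₚ σ τ v = ≡-fromLookup λ j →
  trans (lookup-permute (σ ∘ₚ τ) v j)
        (sym (trans (lookup-permute τ (permute σ v) j) (lookup-permute σ v _)))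

permute-unit : (σ : Permutation′ n) (i : Fin n) → permute σ (unit i) ≡ unit (σ ⟨$⟩ʳ i)
permute-unit σ i = ≡-fromSupp λ j → begin
  Supp (permute σ (unit i)) j  ≡⟨ cong (_≡ true) (lookup-permute σ (unit i) j) ⟩
  Supp (unit i) (σ ⟨$⟩ˡ j)     ∼⟨ Supp-unit i _ ⟩
  σ ⟨$⟩ˡ j ≡ i                 ∼⟨ mk⇔ (λ eq → trans (sym (⟨$⟩ʳ∘⟨$⟩ˡ σ)) (cong (σ ⟨$⟩ʳ_) eq))
                                       (λ eq → trans (cong (σ ⟨$⟩ˡ_) eq) (⟨$⟩ˡ∘⟨$⟩ʳ σ)) ⟩
  j ≡ σ ⟨$⟩ʳ i                 ∼⟨ ⇔-sym (Supp-unit (σ ⟨$⟩ʳ i) j) ⟩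
  Supp (unit (σ ⟨$⟩ʳ i)) j     ∎
  where open EquationalReasoning

Meets-permute : (σ : Permutation′ n) (u w : V n) →
  Meets u w ⇔ Meets (permute σ u) (permute σ w)
Meets-permute σ u w = mk⇔
  (λ (i , su , sw) → σ ⟨$⟩ʳ i , trans (lookup-permute-⟨$⟩ʳ σ u i) su
                               , trans (lookup-permute-⟨$⟩ʳ σ w i) sw)
  (λ (j , su , sw) → σ ⟨$⟩ˡ j , trans (sym (lookup-permute σ u j)) su
                               , trans (sym (lookup-permute σ w j)) sw)

permuteVertex : Permutation′ n → Vertex n → Vertex n
permuteVertex σ (v , i , s) = permute σ v , σ ⟨$⟩ʳ i , trans (lookup-permute-⟨$⟩ʳ σ v i) s

Adj-permute : (σ : Permutation′ n) (u w : Vertex n) →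
  Adj u w ⇔ Adj (permuteVertex σ u) (permuteVertex σ w)
Adj-permute σ (u , _) (w , _) =
  ¬-cong-⇔ (mk⇔ (cong (permute σ)) (permute-injective σ)) ×-cong Meets-permute σ u w

permuteAut : Permutation′ n → Aut n
permuteAut σ = record
  { to        = permuteVertex σ
  ; from      = permuteVertex (flip σ)
  ; to-cong   = cong (permute σ)
  ; from-cong = cong (permute (flip σ))
  ; inverseˡ  = λ u → permute-flip σ (proj₁ u)
  ; inverseʳ  = λ u → permute-flip (flip σ) (proj₁ u)
  ; adj       = Adj-permute σ
  }

NeighbourhoodClique : V n → Set
NeighbourhoodClique {n} u =
  (v w : Vertex n) → Meets u (proj₁ v) → Meets u (proj₁ w) → Meets (proj₁ v) (proj₁ w)

unit-neighbourhoodClique : (i : Fin n) → NeighbourhoodClique (unit i)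
unit-neighbourhoodClique i v w (k , k∈i , k∈v) (l , l∈i , l∈w) =
  i , subst (Supp (proj₁ v)) (Equivalence.to (Supp-unit i k) k∈i) k∈v
    , subst (Supp (proj₁ w)) (Equivalence.to (Supp-unit i l) l∈i) l∈w

neighbourhoodClique⇒unit : {u : V n} {i : Fin n} →
  Supp u i → NeighbourhoodClique u → u ≡ unit i
neighbourhoodClique⇒unit {u = u} {i} su clique = ≡-fromSupp λ k → mk⇔
  (λ sk → Equivalence.from (Supp-unit i k) (supp≡i sk))
  (λ sk → subst (Supp u) (sym (Equivalence.to (Supp-unit i k) sk)) su)
  where
  supp≡i : ∀ {k} → Supp u k → k ≡ i
  supp≡i {k} sk = sym (Equivalence.to (Supp-unit k i) (Equivalence.to (Meets-unit (unit k) i)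
    (clique (unitVertex k) (unitVertex i)
      (Equivalence.from (Meets-unit u k) sk) (Equivalence.from (Meets-unit u i) su))))

module _ (α : Aut n) where

  to-injective : {u w : Vertex n} → to α u ≈V to α w → u ≈V w
  to-injective {u} {w} eq = trans (sym (inverseʳ α u)) (trans (from-cong α eq) (inverseʳ α w))

  -- Two vertices meet iff they are equal or adjacent.
  Meets-to : (u w : Vertex n) →
    Meets (proj₁ u) (proj₁ w) ⇔ Meets (proj₁ (to α u)) (proj₁ (to α w))
  Meets-to u w with ≡-dec _≟ᴮ_ (proj₁ u) (proj₁ w)
  ... | yes u≈w = mk⇔
    (λ _ → subst (Meets (proj₁ (to α u))) (to-cong α u≈w) (Meets-self (to α u)))
    (λ _ → subst (Meets (proj₁ u)) u≈w (Meets-self u))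
  ... | no u≉w = mk⇔
    (λ m → proj₂ (Equivalence.to (adj α u w) (u≉w , m)))
    (λ m → proj₂ (Equivalence.from (adj α u w) ((λ eq → u≉w (to-injective eq)) , m)))

  Meets-from : (u w : Vertex n) →
    Meets (proj₁ u) (proj₁ w) → Meets (proj₁ (from α u)) (proj₁ (from α w))
  Meets-from u w m = Equivalence.from (Meets-to (from α u) (from α w))
    (subst₂ Meets (sym (inverseˡ α u)) (sym (inverseˡ α w)) m)

  to-neighbourhoodClique : (u : Vertex n) →
    NeighbourhoodClique (proj₁ u) → NeighbourhoodClique (proj₁ (to α u))
  to-neighbourhoodClique u clique v w v∼u w∼u =
    subst₂ Meets (inverseˡ α v) (inverseˡ α w)
      (Equivalence.to (Meets-to (from α v) (from α w))
        (clique (from α v) (from α w) (pullback v v∼u) (pullback w w∼u)))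
    where
    pullback : (x : Vertex n) →
      Meets (proj₁ (to α u)) (proj₁ x) → Meets (proj₁ u) (proj₁ (from α x))
    pullback x m = subst (λ y → Meets y (proj₁ (from α x))) (inverseʳ α u) (Meets-from (to α u) x m)

  basisImage : Fin n → Fin n
  basisImage i = proj₁ (proj₂ (to α (unitVertex i)))

  basisPreimage : Fin n → Fin n
  basisPreimage j = proj₁ (proj₂ (from α (unitVertex j)))

  to-unit : (i : Fin n) → proj₁ (to α (unitVertex i)) ≡ unit (basisImage i)
  to-unit i = neighbourhoodClique⇒unit (proj₂ (proj₂ (to α (unitVertex i))))
    (to-neighbourhoodClique (unitVertex i) (unit-neighbourhoodClique i))

  Supp-to : (u : Vertex n) (i : Fin n) →
    Supp (proj₁ (to α u)) (basisImage i) ⇔ Supp (proj₁ u) i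
  Supp-to u i = begin
    Supp αu (basisImage i)                   ∼⟨ ⇔-sym (Meets-unit αu (basisImage i)) ⟩
    Meets αu (unit (basisImage i))           ≡⟨ cong (Meets αu) (to-unit i) ⟨
    Meets αu (proj₁ (to α (unitVertex i)))   ∼⟨ ⇔-sym (Meets-to u (unitVertex i)) ⟩
    Meets (proj₁ u) (unit i)                 ∼⟨ Meets-unit (proj₁ u) i ⟩
    Supp (proj₁ u) i                         ∎
    where
    open EquationalReasoning
    αu : V n
    αu = proj₁ (to α u)

  lookup-to : (u : Vertex n) (i : Fin n) →
    lookup (proj₁ (to α u)) (basisImage i) ≡ lookup (proj₁ u) i
  lookup-to u i = ⇔→≡ (Supp-to u i)

  basisImage-injective : {i k : Fin n} → basisImage i ≡ basisImage k → i ≡ k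
  basisImage-injective {i} {k} eq = Equivalence.to (Supp-unit k i)
    (Equivalence.to (Supp-to (unitVertex k) i)
      (subst (Supp (proj₁ (to α (unitVertex k)))) (sym eq) (proj₂ (proj₂ (to α (unitVertex k))))))

  basisImage∘basisPreimage : (j : Fin n) → basisImage (basisPreimage j) ≡ j
  basisImage∘basisPreimage j = Equivalence.to (Supp-unit j _)
    (subst (λ v → Supp v (basisImage (basisPreimage j))) (inverseˡ α (unitVertex j))
      (Equivalence.from (Supp-to (from α (unitVertex j)) (basisPreimage j))
        (proj₂ (proj₂ (from α (unitVertex j))))))

  basisPermutation : Permutation′ n
  basisPermutation = permutation basisImage basisPreimage basisImage∘basisPreimage
    (λ i → basisImage-injective (basisImage∘basisPreimage (basisImage i)))

  permuteAut-basisPermutation : permuteAut basisPermutation ≈A α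
  permuteAut-basisPermutation u = ≡-fromLookup λ j → begin
    lookup (permute basisPermutation (proj₁ u)) j   ≡⟨ lookup-permute basisPermutation (proj₁ u) j ⟩
    lookup (proj₁ u) (basisPreimage j)              ≡⟨ lookup-to u (basisPreimage j) ⟨
    lookup αu (basisImage (basisPreimage j))        ≡⟨ cong (lookup αu) (basisImage∘basisPreimage j) ⟩
    lookup αu j                                     ∎
    where
    open ≡-Reasoning
    αu : V n
    αu = proj₁ (to α u)

≈P⇒⟨$⟩ˡ-≡ : (σ τ : Permutation′ n) → σ ≈P τ → ∀ j → σ ⟨$⟩ˡ j ≡ τ ⟨$⟩ˡ j
≈P⇒⟨$⟩ˡ-≡ σ τ σ≈τ j = begin
  σ ⟨$⟩ˡ j                       ≡⟨ ⟨$⟩ˡ∘⟨$⟩ʳ τ ⟨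
  τ ⟨$⟩ˡ (τ ⟨$⟩ʳ (σ ⟨$⟩ˡ j))     ≡⟨ cong (τ ⟨$⟩ˡ_) (σ≈τ (σ ⟨$⟩ˡ j)) ⟨
  τ ⟨$⟩ˡ (σ ⟨$⟩ʳ (σ ⟨$⟩ˡ j))     ≡⟨ cong (τ ⟨$⟩ˡ_) (⟨$⟩ʳ∘⟨$⟩ˡ σ) ⟩
  τ ⟨$⟩ˡ j                       ∎
  where open ≡-Reasoning

permuteAut-cong : (σ τ : Permutation′ n) → σ ≈P τ → permuteAut σ ≈A permuteAut τ
permuteAut-cong σ τ σ≈τ u =
  tabulate-cong λ j → cong (lookup (proj₁ u)) (≈P⇒⟨$⟩ˡ-≡ σ τ σ≈τ j)

permuteAut-injective : (σ τ : Permutation′ n) → permuteAut σ ≈A permuteAut τ → σ ≈P τ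
permuteAut-injective σ τ eq i = unit-injective (begin
  unit (σ ⟨$⟩ʳ i)      ≡⟨ permute-unit σ i ⟨
  permute σ (unit i)   ≡⟨ eq (unitVertex i) ⟩
  permute τ (unit i)   ≡⟨ permute-unit τ i ⟩
  unit (τ ⟨$⟩ʳ i)      ∎)
  where open ≡-Reasoning

mainTheorem5 : (n : ℕ) → SymIsoAut n
mainTheorem5 n = permuteAut , record
  { cong       = λ {σ} {τ} → permuteAut-cong σ τ
  ; homo       = λ σ τ u → permute-∘ₚ σ τ (proj₁ u)
  ; injective  = λ {σ} {τ} → permuteAut-injective σ τ
  ; surjective = λ α → basisPermutation α , permuteAut-basisPermutation α
  }
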